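{- For all positive integers $n \ge k$, \[ F(n,k) \ge \left\lfloor \frac{n}{k}\right\rfloor^k F(k,k). \]
   Context: A word of length $k$ over $[n]=\{1,\dots,n\}$ is a sequence $(w_1,\dots,w_k)$ with $w_i\in[n]$; it is repetition-free if each symbol occurs at most once. Two words $w,x$ of length $k$ have a reverse if there are positions $i,j$ with $w_i\ne w_j$, $w_i=x_j$ and $w_j=x_i$. A set of words is reverse-free if no two of its words have a reverse. $F(n,k)$ is the maximum size of a reverse-free set of repetition-free words of length $k$ over $[n]$. -}

module Defs where

open import Data.Nat using (ℕ; _≤_; _*_; _^_; _/_; NonZero)
open import Data.Fin using (Fin)
open import Data.Vec using (Vec; lookup)
open import Data.List using (List; length)
open import Data.List.Membership.Propositional using (_∈_)
open import Data.List.Relation.Unary.Unique.Propositional using (Unique)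
open import Data.Product using (Σ; ∃; ∃-syntax; _×_)
open import Relation.Binary.PropositionalEquality using (_≡_; _≢_)
open import Relation.Nullary using (¬_)

-- A word of length k over [n] = {1,…,n}; the alphabet is represented by Fin n.
Word : ℕ → ℕ → Set
Word n k = Vec (Fin n) k

RepetitionFree : ∀ {n k} → Word n k → Set
RepetitionFree {k = k} w = ∀ (i j : Fin k) → lookup w i ≡ lookup w j → i ≡ j

HaveReverse : ∀ {n k} → Word n k → Word n k → Set
HaveReverse {k = k} w x =
  ∃[ i ] ∃[ j ] (lookup w i ≢ lookup w j × lookup w i ≡ lookup x j × lookup w j ≡ lookup x i)

ReverseFree : ∀ {n k} → List (Word n k) → Set
ReverseFree S = ∀ {w x} → w ∈ S → x ∈ S → ¬ HaveReverse w x

IsRFSet : (n k : ℕ) → List (Word n k) → Set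
IsRFSet n k S = Unique S × (∀ {w} → w ∈ S → RepetitionFree w) × ReverseFree S

-- F(n,k) ≥ m : some admissible set has exactly m elements
-- (F(n,k) is the maximum of such m; the family of admissible sets is finite
--  and downward closed, so "F(n,k) ≥ m" is exactly the existence of such a set)
FAtLeast : ℕ → ℕ → ℕ → Set
FAtLeast n k m = ∃[ S ] (IsRFSet n k S × m ≤ length S)

IsF : ℕ → ℕ → ℕ → Set
IsF n k m = FAtLeast n k m × (∀ (S : List (Word n k)) → IsRFSet n k S → length S ≤ m)

-- Fix q colours with q·m ≤ n.  A letter a ∈ [m] painted with colour c ∈ [q]
-- becomes the symbol (c,a) ∈ [q]×[m] ↪ [n].  A word w of length k over [m]
-- together with a colouring c ∈ [q]^k of its positions thus yields a word
-- blowUp w c over [n].  Since the symbol (c,a) remembers both a and c, equal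
-- symbols in blown-up words force equal letters (and equal colours) in the
-- original words.  Hence blowing up every word of a reverse-free set S of
-- repetition-free words with every colouring gives a reverse-free set of
-- repetition-free words over [n] of size q^k · |S|.
--
-- The theorem is the case m = k, q = ⌊n/k⌋.
module Submission where

open import Defs
open import Data.Nat using (ℕ; zero; suc; _≤_; _+_; _*_; _^_; _/_; NonZero)
open import Data.Nat.Properties using (*-monoʳ-≤; *-comm)
open import Data.Nat.DivMod using (m/n*n≤m)
open import Data.Fin using (Fin; inject≤; combine)
open import Data.Fin.Properties using (inject≤-injective; combine-injective)
open import Data.Vec using (Vec; []; _∷_; lookup; tabulate)
open import Data.Vec.Properties
  using (lookup∘tabulate; tabulate∘lookup; tabulate-cong; ∷-injective)
open import Data.List using (List; []; _∷_; length; map; _++_; allFin; cartesianProductWith; [_])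
open import Data.List.Properties using (length-map; length-++; length-tabulate)
open import Data.List.Membership.Propositional using (_∈_)
open import Data.List.Membership.Propositional.Properties using (∈-cartesianProductWith⁻)
open import Data.List.Relation.Unary.Unique.Propositional using (Unique)
open import Data.List.Relation.Unary.Unique.Propositional.Properties
  using (cartesianProductWith⁺; allFin⁺)
import Data.List.Relation.Unary.All as All
import Data.List.Relation.Unary.AllPairs as AllPairs
open import Data.Product using (_×_; _,_; proj₁; proj₂)
open import Relation.Nullary using (¬_)
open import Relation.Binary.PropositionalEquality
  using (_≡_; refl; sym; trans; subst; cong; cong₂; module ≡-Reasoning)

vec-ext : ∀ {A : Set} {k} (u v : Vec A k) → (∀ i → lookup u i ≡ lookup v i) → u ≡ v
vec-ext u v agree = trans (sym (tabulate∘lookup u)) (trans (tabulate-cong agree) (tabulate∘lookup v))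

length-cartesianProductWith : ∀ {A B C : Set} (f : A → B → C) (xs : List A) (ys : List B) →
                              length (cartesianProductWith f xs ys) ≡ length xs * length ys
length-cartesianProductWith f [] ys = refl
length-cartesianProductWith f (x ∷ xs) ys = begin
  length (map (f x) ys ++ cartesianProductWith f xs ys)
    ≡⟨ length-++ (map (f x) ys) ⟩
  length (map (f x) ys) + length (cartesianProductWith f xs ys)
    ≡⟨ cong₂ _+_ (length-map (f x) ys) (length-cartesianProductWith f xs ys) ⟩
  length ys + length xs * length ys
    ∎
  where open ≡-Reasoning

allVecs : (q k : ℕ) → List (Vec (Fin q) k)
allVecs q zero    = [ [] ]
allVecs q (suc k) = cartesianProductWith _∷_ (allFin q) (allVecs q k)

allVecs-length : ∀ q k → length (allVecs q k) ≡ q ^ k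
allVecs-length q zero    = refl
allVecs-length q (suc k) = trans (length-cartesianProductWith _∷_ (allFin q) (allVecs q k))
  (cong₂ _*_ (length-tabulate {n = q} (λ i → i)) (allVecs-length q k))

allVecs-unique : ∀ q k → Unique (allVecs q k)
allVecs-unique q zero    = All.[] AllPairs.∷ AllPairs.[]
allVecs-unique q (suc k) = cartesianProductWith⁺ _∷_ ∷-injective (allFin⁺ q) (allVecs-unique q k)

module BlowUp {m n q : ℕ} (k : ℕ) (q*m≤n : q * m ≤ n) where

  symbol : Fin q → Fin m → Fin n
  symbol c a = inject≤ (combine c a) q*m≤n

  symbol-injective : ∀ {c d a b} → symbol c a ≡ symbol d b → a ≡ b × c ≡ d
  symbol-injective {c} {d} {a} {b} eq
    with c≡d , a≡b ← combine-injective c a d b (inject≤-injective q*m≤n q*m≤n _ _ eq)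
    = a≡b , c≡d

  blowUp : Word m k → Vec (Fin q) k → Word n k
  blowUp w c = tabulate (λ i → symbol (lookup c i) (lookup w i))

  blowUp-match : ∀ w c x d i j → lookup (blowUp w c) i ≡ lookup (blowUp x d) j →
                 lookup w i ≡ lookup x j × lookup c i ≡ lookup d j
  blowUp-match w c x d i j eq = symbol-injective
    (trans (sym (lookup∘tabulate _ i)) (trans eq (lookup∘tabulate _ j)))

  blowUp-injective : ∀ {w x c d} → blowUp w c ≡ blowUp x d → w ≡ x × c ≡ d
  blowUp-injective {w} {x} {c} {d} eq =
    vec-ext w x (λ i → proj₁ (match i)) , vec-ext c d (λ i → proj₂ (match i))
    where
    match : ∀ i → lookup w i ≡ lookup x i × lookup c i ≡ lookup d i
    match i = blowUp-match w c x d i i (cong (λ v → lookup v i) eq)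

  blowUp-repetitionFree : ∀ w c → RepetitionFree w → RepetitionFree (blowUp w c)
  blowUp-repetitionFree w c rf i j eq = rf i j (proj₁ (blowUp-match w c w c i j eq))

  -- A reverse between blown-up words is a reverse between the original words;
  -- the distinctness of the two letters of w uses that w is repetition-free.
  blowUp-reverse : ∀ w c x d → RepetitionFree w →
                   HaveReverse (blowUp w c) (blowUp x d) → HaveReverse w x
  blowUp-reverse w c x d rf (i , j , distinct , eᵢⱼ , eⱼᵢ) =
    i , j , letters-distinct ,
    proj₁ (blowUp-match w c x d i j eᵢⱼ) , proj₁ (blowUp-match w c x d j i eⱼᵢ)
    where
    letters-distinct : ¬ lookup w i ≡ lookup w j
    letters-distinct eq with refl ← rf i j eq = distinct refl

  blowUpSet : List (Word m k) → List (Word n k)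
  blowUpSet S = cartesianProductWith blowUp S (allVecs q k)

  blowUpSet-length : ∀ S → length (blowUpSet S) ≡ q ^ k * length S
  blowUpSet-length S = begin
    length (blowUpSet S)            ≡⟨ length-cartesianProductWith blowUp S (allVecs q k) ⟩
    length S * length (allVecs q k) ≡⟨ cong (length S *_) (allVecs-length q k) ⟩
    length S * q ^ k                ≡⟨ *-comm (length S) (q ^ k) ⟩
    q ^ k * length S                ∎
    where open ≡-Reasoning

  blowUpSet-isRFSet : ∀ S → IsRFSet m k S → IsRFSet n k (blowUpSet S)
  blowUpSet-isRFSet S (unique , repFree , revFree) =
    cartesianProductWith⁺ blowUp blowUp-injective unique (allVecs-unique q k) ,
    repFree′ , revFree′
    where
    repFree′ : ∀ {u} → u ∈ blowUpSet S → RepetitionFree u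
    repFree′ u∈ with w , c , w∈ , _ , refl ← ∈-cartesianProductWith⁻ blowUp S (allVecs q k) u∈
      = blowUp-repetitionFree w c (repFree w∈)

    revFree′ : ReverseFree (blowUpSet S)
    revFree′ u∈ v∈ reverse
      with w , c , w∈ , _ , refl ← ∈-cartesianProductWith⁻ blowUp S (allVecs q k) u∈
         | x , d , x∈ , _ , refl ← ∈-cartesianProductWith⁻ blowUp S (allVecs q k) v∈
      = revFree w∈ x∈ (blowUp-reverse w c x d (repFree w∈) reverse)

blowUp-bound : ∀ {m n q} k f → q * m ≤ n → FAtLeast m k f → FAtLeast n k (q ^ k * f)
blowUp-bound {m} {n} {q} k f q*m≤n (S , isRFSet , f≤|S|) =
  blowUpSet S , blowUpSet-isRFSet S isRFSet ,
  subst (q ^ k * f ≤_) (sym (blowUpSet-length S)) (*-monoʳ-≤ (q ^ k) f≤|S|)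
  where open BlowUp {m} {n} {q} k q*m≤n

-- The case m = k, q = ⌊n/k⌋, using ⌊n/k⌋ · k ≤ n.
lemma2 : (n k : ℕ) → .{{_ : NonZero k}} → k ≤ n →
         (f : ℕ) → IsF k k f →
         FAtLeast n k ((n / k) ^ k * f)
lemma2 n k _ f (attained , _) = blowUp-bound k f (m/n*n≤m n k) attained
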